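{- A low-defect polynomial $f$ of degree $1$ is substantial if and only if it can be written as $ax+1$ with $a$ a stable natural number, or as $b(ax+1)$ with $a,b$ natural numbers such that $ab$ is stable and $\|ab\|=\|a\|+\|b\|$.
   Context: $\|n\|$ denotes the integer complexity of $n\in\mathbb{N}$ (least number of $1$'s needed to write $n$ using $1$, $+$, $\cdot$ and parentheses). $n$ is stable if $\|3^kn\|=3k+\|n\|$ for all $k\ge0$; the stable complexity is $\|n\|_{\mathrm{st}}=\|3^kn\|-3k$ for any $k$ with $3^kn$ stable. Low-defect pairs: the smallest subset $\mathscr{P}$ of $\mathbb{Z}[x_1,x_2,\ldots]\times\mathbb{N}$ such that (i) $(k,C)\in\mathscr{P}$ for constant $k\in\mathbb{N}$ and $C\ge\|k\|$; (ii) $(f_1,C_1),(f_2,C_2)\in\mathscr{P}$ implies $(f_1\otimes f_2,C_1+C_2)\in\mathscr{P}$, where $f_1\otimes f_2$ is the product after relabeling variables to be disjoint; (iii) $(f,C)\in\mathscr{P}$, $c\in\mathbb{N}$, $D\ge\|c\|$ imply $(f\cdot x+c,C+D)\in\mathscr{P}$ with $x$ a new variable. Low-defect polynomials are the first coordinates (variables may be renamed); each is multilinear with degree equal to its number of variables and nonzero leading coefficient $a$ (coefficient of the product of all variables). $\|f\|$ is the least $C$ with $(f,C)\in\mathscr{P}$, and $f$ is substantial if $\|f\|=\|a\|_{\mathrm{st}}+\deg f$. -}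

module Defs where

open import Data.Nat using (ℕ; zero; suc; _+_; _*_; _∸_; _^_; _≤_)
open import Data.Bool using (Bool; true; false; _∧_; not)
open import Data.Vec using (Vec; []; _∷_; take; drop)
open import Data.Product using (Σ; ∃; _×_; _,_)
open import Relation.Binary.PropositionalEquality using (_≡_)

data Expr : Set where
  one : Expr
  _⊕_ : Expr → Expr → Expr
  _⊛_ : Expr → Expr → Expr

eval : Expr → ℕ
eval one       = 1
eval (e ⊕ e′)  = eval e + eval e′
eval (e ⊛ e′)  = eval e * eval e′

ones : Expr → ℕ
ones one      = 1
ones (e ⊕ e′) = ones e + ones e′
ones (e ⊛ e′) = ones e + ones e′

Cpx : ℕ → ℕ → Set
Cpx n m = (Σ Expr λ e → eval e ≡ n × ones e ≡ m)
        × (∀ (e : Expr) → eval e ≡ n → m ≤ ones e)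

Stable : ℕ → Set
Stable n = Σ ℕ λ m → Cpx n m × (∀ (k : ℕ) → Cpx (3 ^ k * n) (3 * k + m))

StCpx : ℕ → ℕ → Set
StCpx n s = Σ ℕ λ k → Stable (3 ^ k * n) ×
            (Σ ℕ λ c → Cpx (3 ^ k * n) c × s ≡ c ∸ 3 * k)

CpxAdditive : ℕ → ℕ → Set
CpxAdditive a b = Σ ℕ λ ma → Σ ℕ λ mb →
  Cpx a ma × Cpx b mb × Cpx (a * b) (ma + mb)

-- Multilinear polynomials with natural-number coefficients in n
-- variables, represented by their coefficient function: a monomial is a
-- subset of the variables, given as a Vec Bool n (as in Data.Fin.Subset).

Monomial : ℕ → Set
Monomial n = Vec Bool n

MPoly : ℕ → Set
MPoly n = Monomial n → ℕ

_≗ₚ_ : ∀ {n} → MPoly n → MPoly n → Set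
f ≗ₚ g = ∀ S → f S ≡ g S

isEmpty : ∀ {n} → Monomial n → Bool
isEmpty []       = true
isEmpty (b ∷ S)  = not b ∧ isEmpty S

constP : ℕ → MPoly 0
constP k _ = k

_⊗ₚ_ : ∀ {m n} → MPoly m → MPoly n → MPoly (m + n)
_⊗ₚ_ {m} f₁ f₂ S = f₁ (take m S) * f₂ (drop m S)

-- f · x + c, with x a new variable (placed first)
linP : ∀ {n} → MPoly n → ℕ → MPoly (suc n)
linP f c (true  ∷ S) = f S
linP f c (false ∷ S) with isEmpty S
... | true  = c
... | false = 0

-- Low-defect pairs: the smallest set 𝒫 of pairs (f , C), as an
-- inductive predicate.  ‖k‖ ≤ C is written as "k has an expression
-- using at most C ones".

HasCpxLE : ℕ → ℕ → Set
HasCpxLE k C = Σ Expr λ e → eval e ≡ k × ones e ≤ C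

data LDPair : (n : ℕ) → MPoly n → ℕ → Set where
  const  : ∀ (k C : ℕ) → 1 ≤ k → HasCpxLE k C → LDPair 0 (constP k) C
  tensor : ∀ {m n f₁ f₂ C₁ C₂} → LDPair m f₁ C₁ → LDPair n f₂ C₂ →
           LDPair (m + n) (f₁ ⊗ₚ f₂) (C₁ + C₂)
  affine : ∀ {n f C} (c D : ℕ) → LDPair n f C → 1 ≤ c → HasCpxLE c D →
           LDPair (suc n) (linP f c) (C + D)

InP : ∀ {n} → MPoly n → ℕ → Set
InP {n} f C = Σ (MPoly n) λ g → LDPair n g C × g ≗ₚ f

LowDefect : ∀ {n} → MPoly n → Set
LowDefect f = Σ ℕ λ C → InP f C

LDCpx : ∀ {n} → MPoly n → ℕ → Set
LDCpx f C = InP f C × (∀ C′ → InP f C′ → C ≤ C′)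

allVars : ∀ n → Monomial n
allVars zero    = []
allVars (suc n) = true ∷ allVars n

leading : ∀ {n} → MPoly n → ℕ
leading {n} f = f (allVars n)

-- f is substantial: ‖f‖ = ‖a‖_st + deg f   (deg f = n)
Substantial : ∀ {n} → MPoly n → Set
Substantial {n} f = Σ ℕ λ C → Σ ℕ λ s →
  LDCpx f C × StCpx (leading f) s × C ≡ s + n

ax+c : ℕ → ℕ → MPoly 1
ax+c a c (true  ∷ []) = a
ax+c a c (false ∷ []) = c

-- Every degree-1 low-defect pair has the shape B · (a x + c) with expressions for a, c and
-- (unless B = 1) for B, of total cost at most C. If f is substantial with ‖a B‖_st = s, then
-- s + 1 = C bounds that cost while s is a lower bound for any expression of B a, so c is
-- written with a single 1 and the expression of B a is optimal; an optimal expression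
-- attaining the stable complexity forces B a to be stable. An optimal expression of a
-- product makes the complexity additive. Conversely such an f is built directly, and every
-- pair for f costs at least ‖B a‖ + 1.
module Submission where

open import Defs
open import Data.Bool using (true; false)
open import Data.Empty using (⊥-elim)
open import Data.Maybe using (Maybe; nothing; just)
open import Data.Nat using (ℕ; zero; suc; _+_; _*_; _∸_; _^_; _≤_; _<_; z≤n; s≤s)
open import Data.Nat.Properties
open import Data.Product using (Σ; _×_; _,_; proj₁; proj₂)
open import Data.Sum using (_⊎_; inj₁; inj₂)
open import Data.Unit using (⊤; tt)
open import Data.Vec using ([]; _∷_)
open import Function.Bundles using (_⇔_; mk⇔)
open import Relation.Binary.PropositionalEquality
import Algebra.Properties.CommutativeSemigroup as CommSemigroupProperties

private
  module +-CS = CommSemigroupProperties +-commutativeSemigroup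
  module *-CS = CommSemigroupProperties *-commutativeSemigroup

evalPos : ∀ e → 1 ≤ eval e
evalPos one      = s≤s z≤n
evalPos (e ⊕ e′) = ≤-trans (evalPos e) (m≤m+n (eval e) (eval e′))
evalPos (e ⊛ e′) = *-mono-≤ (evalPos e) (evalPos e′)

onesPos : ∀ e → 1 ≤ ones e
onesPos one      = s≤s z≤n
onesPos (e ⊕ e′) = ≤-trans (onesPos e) (m≤m+n (ones e) (ones e′))
onesPos (e ⊛ e′) = ≤-trans (onesPos e) (m≤m+n (ones e) (ones e′))

ones≤1⇒eval≡1 : ∀ e → ones e ≤ 1 → eval e ≡ 1
ones≤1⇒eval≡1 one      _  = refl
ones≤1⇒eval≡1 (e ⊕ e′) le = ⊥-elim (<⇒≱ (+-mono-≤ (onesPos e) (onesPos e′)) le)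
ones≤1⇒eval≡1 (e ⊛ e′) le = ⊥-elim (<⇒≱ (+-mono-≤ (onesPos e) (onesPos e′)) le)

three : Expr
three = (one ⊕ one) ⊕ one

times3^ : ℕ → Expr → Expr
times3^ zero    e = e
times3^ (suc k) e = three ⊛ times3^ k e

eval-times3^ : ∀ k e → eval (times3^ k e) ≡ 3 ^ k * eval e
eval-times3^ zero    e = sym (*-identityˡ (eval e))
eval-times3^ (suc k) e = begin
  3 * eval (times3^ k e) ≡⟨ cong (3 *_) (eval-times3^ k e) ⟩
  3 * (3 ^ k * eval e)   ≡⟨ *-assoc 3 (3 ^ k) (eval e) ⟨
  3 ^ suc k * eval e     ∎
  where open ≡-Reasoning

ones-times3^ : ∀ k e → ones (times3^ k e) ≡ 3 * k + ones e
ones-times3^ zero    e = refl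
ones-times3^ (suc k) e = begin
  3 + ones (times3^ k e) ≡⟨ cong (3 +_) (ones-times3^ k e) ⟩
  3 + (3 * k + ones e)   ≡⟨ +-assoc 3 (3 * k) (ones e) ⟨
  3 + 3 * k + ones e     ≡⟨ cong (_+ ones e) (*-suc 3 k) ⟨
  3 * suc k + ones e     ∎
  where open ≡-Reasoning

LowerBound : ℕ → ℕ → Set
LowerBound n m = ∀ e → eval e ≡ n → m ≤ ones e

Optimal : Expr → Set
Optimal e = LowerBound (eval e) (ones e)

optimal⇒cpx : ∀ e → Optimal e → Cpx (eval e) (ones e)
optimal⇒cpx e opt = (e , refl , refl) , opt

cpx-unique : ∀ {n m m′} → Cpx n m → Cpx n m′ → m ≡ m′
cpx-unique ((e , ev , on) , lb) ((e′ , ev′ , on′) , lb′) =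
  ≤-antisym (subst (_ ≤_) on′ (lb e′ ev′)) (subst (_ ≤_) on (lb′ e ev))

lowerBound-3^-∸ : ∀ {n c} k → LowerBound (3 ^ k * n) c → LowerBound n (c ∸ 3 * k)
lowerBound-3^-∸ {n} {c} k lb e ev = m≤n+o⇒m∸n≤o c (3 * k)
  (subst (c ≤_) (ones-times3^ k e)
    (lb (times3^ k e) (trans (eval-times3^ k e) (cong (3 ^ k *_) ev))))

lowerBound-3^-+ : ∀ {n m} k → LowerBound (3 ^ k * n) (3 * k + m) → LowerBound n m
lowerBound-3^-+ {m = m} k lb e ev =
  subst (_≤ ones e) (m+n∸m≡n (3 * k) m) (lowerBound-3^-∸ k lb e ev)

stCpx-lowerBound : ∀ {n s} → StCpx n s → LowerBound n s
stCpx-lowerBound (k , _ , c , (_ , lb) , refl) = lowerBound-3^-∸ k lb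

optimal-⊛ˡ : ∀ e₁ e₂ → Optimal (e₁ ⊛ e₂) → Optimal e₁
optimal-⊛ˡ e₁ e₂ opt e ev =
  +-cancelʳ-≤ (ones e₂) (ones e₁) (ones e) (opt (e ⊛ e₂) (cong (_* eval e₂) ev))

optimal-⊛ʳ : ∀ e₁ e₂ → Optimal (e₁ ⊛ e₂) → Optimal e₂
optimal-⊛ʳ e₁ e₂ opt e ev =
  +-cancelˡ-≤ (ones e₁) (ones e₂) (ones e) (opt (e₁ ⊛ e) (cong (eval e₁ *_) ev))

optimal-⊛-comm : ∀ e₁ e₂ → Optimal (e₁ ⊛ e₂) → Optimal (e₂ ⊛ e₁)
optimal-⊛-comm e₁ e₂ opt e ev =
  subst (_≤ ones e) (+-comm (ones e₁) (ones e₂))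
    (opt e (trans ev (*-comm (eval e₂) (eval e₁))))

optimal-⊛⇒cpxAdditive : ∀ e₁ e₂ → Optimal (e₁ ⊛ e₂) → CpxAdditive (eval e₂) (eval e₁)
optimal-⊛⇒cpxAdditive e₁ e₂ opt =
  ones e₂ , ones e₁ ,
  optimal⇒cpx e₂ (optimal-⊛ʳ e₁ e₂ opt) , optimal⇒cpx e₁ (optimal-⊛ˡ e₁ e₂ opt) ,
  optimal⇒cpx (e₂ ⊛ e₁) (optimal-⊛-comm e₁ e₂ opt)

stable⇒stCpx : ∀ {n m} → Stable n → Cpx n m → StCpx n m
stable⇒stCpx {n} {m} st cm =
  0 , subst Stable (sym (*-identityˡ n)) st ,
  m , subst (λ x → Cpx x m) (sym (*-identityˡ n)) cm , refl

stable-3^-reflect : ∀ {n s} k E → Stable (3 ^ k * n) → Cpx (3 ^ k * n) (3 * k + s) →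
                    eval E ≡ n → ones E ≡ s → Stable n
stable-3^-reflect {n} {s} k E (m′ , cm′ , stab) cm ev refl =
  s , ((E , ev , refl) , lowerBound-3^-+ k (proj₂ cm)) , cpx-3^
  where
  m′≡ : m′ ≡ 3 * k + s
  m′≡ = cpx-unique cm′ cm

  cpx-3^ : ∀ j → Cpx (3 ^ j * n) (3 * j + s)
  cpx-3^ j =
    (times3^ j E , trans (eval-times3^ j E) (cong (3 ^ j *_) ev) , ones-times3^ j E) ,
    lowerBound-3^-+ k (subst₂ LowerBound
      (*-CS.x∙yz≈y∙xz (3 ^ j) (3 ^ k) n)
      (trans (cong (3 * j +_) m′≡) (+-CS.x∙yz≈y∙xz (3 * j) (3 * k) s))
      (proj₂ (stab j)))

-- An expression attaining ‖n‖_st = ‖3^k n‖ − 3k shows that the truncated subtraction does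
-- not truncate, so ‖3^k n‖ = 3k + ones E and stability descends from 3^k n to n.
stCpx-attained⇒stable : ∀ {n s} E → StCpx n s → eval E ≡ n → ones E ≤ s → Stable n
stCpx-attained⇒stable {n} {s} E sc@(k , st , c , cc , s≡) ev E≤s =
  stable-3^-reflect k E st (subst (Cpx (3 ^ k * n)) c≡ cc) ev E≡s
  where
  E≡s : ones E ≡ s
  E≡s = ≤-antisym E≤s (stCpx-lowerBound sc E ev)

  3k<c : 3 * k < c
  3k<c = m∸n≢0⇒n<m λ c∸3k≡0 →
    <⇒≱ (onesPos E) (≤-trans E≤s (≤-reflexive (trans s≡ c∸3k≡0)))

  c≡ : c ≡ 3 * k + s
  c≡ = trans (sym (m+[n∸m]≡n (<⇒≤ 3k<c))) (cong (3 * k +_) (sym s≡))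

_⊛?_ : Maybe Expr → Expr → Expr
nothing ⊛? e = e
just b  ⊛? e = b ⊛ e

evalM : Maybe Expr → ℕ
evalM nothing  = 1
evalM (just b) = eval b

scaleBy : Expr → Maybe Expr → Maybe Expr
scaleBy E nothing  = just E
scaleBy E (just b) = just (E ⊛ b)

eval-scaleBy-⊛? : ∀ E mb e → eval (scaleBy E mb ⊛? e) ≡ eval E * eval (mb ⊛? e)
eval-scaleBy-⊛? E nothing  e = refl
eval-scaleBy-⊛? E (just b) e = *-assoc (eval E) (eval b) (eval e)

ones-scaleBy-⊛? : ∀ E mb e → ones (scaleBy E mb ⊛? e) ≡ ones E + ones (mb ⊛? e)
ones-scaleBy-⊛? E nothing  e = refl
ones-scaleBy-⊛? E (just b) e = +-assoc (ones E) (ones b) (ones e)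

evalM-scaleBy : ∀ E mb → evalM (scaleBy E mb) ≡ eval E * evalM mb
evalM-scaleBy E nothing  = sym (*-identityʳ (eval E))
evalM-scaleBy E (just b) = refl

-- f = B (a x + c), where the optional scalar expression stands for B and costs nothing
-- when absent (B = 1).
record AffineShape (f : MPoly 1) (C : ℕ) : Set where
  field
    scalar     : Maybe Expr
    slope      : Expr
    offset     : Expr
    leading-eq : f (true ∷ []) ≡ eval (scalar ⊛? slope)
    offset-eq  : f (false ∷ []) ≡ evalM scalar * eval offset
    cost       : ones (scalar ⊛? slope) + ones offset ≤ C

affineShape-scale : ∀ {g h : MPoly 1} {k C D} → HasCpxLE k D → AffineShape g C →
                    (∀ S → h S ≡ k * g S) → AffineShape h (D + C)
affineShape-scale {g} {h} {k} (E , ev , E≤D) σ h≡kg = record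
  { scalar     = scaleBy E scalar
  ; slope      = slope
  ; offset     = offset
  ; leading-eq = begin
      h (true ∷ [])                    ≡⟨ h≡kg _ ⟩
      k * g (true ∷ [])                ≡⟨ cong₂ _*_ (sym ev) leading-eq ⟩
      eval E * eval (scalar ⊛? slope)  ≡⟨ eval-scaleBy-⊛? E scalar slope ⟨
      eval (scaleBy E scalar ⊛? slope) ∎
  ; offset-eq  = begin
      h (false ∷ [])                          ≡⟨ h≡kg _ ⟩
      k * g (false ∷ [])                      ≡⟨ cong₂ _*_ (sym ev) offset-eq ⟩
      eval E * (evalM scalar * eval offset)   ≡⟨ *-assoc (eval E) (evalM scalar) (eval offset) ⟨
      eval E * evalM scalar * eval offset     ≡⟨ cong (_* eval offset) (evalM-scaleBy E scalar) ⟨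
      evalM (scaleBy E scalar) * eval offset  ∎
  ; cost       = ≤-trans
      (≤-reflexive (trans (cong (_+ ones offset) (ones-scaleBy-⊛? E scalar slope))
                          (+-assoc (ones E) (ones (scalar ⊛? slope)) (ones offset))))
      (+-mono-≤ E≤D cost)
  }
  where
  open AffineShape σ
  open ≡-Reasoning

affineShape-resp : ∀ {f g C} → g ≗ₚ f → AffineShape g C → AffineShape f C
affineShape-resp g≗f σ = record
  { scalar = scalar ; slope = slope ; offset = offset
  ; leading-eq = trans (sym (g≗f _)) leading-eq
  ; offset-eq  = trans (sym (g≗f _)) offset-eq
  ; cost = cost
  }
  where open AffineShape σ

LowDegreeShape : (n : ℕ) → MPoly n → ℕ → Set
LowDegreeShape zero          g C = HasCpxLE (g []) C
LowDegreeShape (suc zero)    g C = AffineShape g C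
LowDegreeShape (suc (suc _)) _ _ = ⊤

lowDegreeShape : ∀ {n g C} → LDPair n g C → LowDegreeShape n g C
lowDegreeShape (const k C _ h) = h
lowDegreeShape (tensor {zero} {zero} p q) with lowDegreeShape p | lowDegreeShape q
... | E₁ , ev₁ , le₁ | E₂ , ev₂ , le₂ = E₁ ⊛ E₂ , cong₂ _*_ ev₁ ev₂ , +-mono-≤ le₁ le₂
lowDegreeShape (tensor {zero} {suc zero} p q) =
  affineShape-scale (lowDegreeShape p) (lowDegreeShape q) λ { (_ ∷ []) → refl }
lowDegreeShape (tensor {suc zero} {zero} {f₁} {f₂} {C₁} {C₂} p q) =
  subst (AffineShape _) (+-comm C₂ C₁)
    (affineShape-scale (lowDegreeShape q) (lowDegreeShape p) λ { (x ∷ []) → *-comm (f₁ (x ∷ [])) (f₂ []) })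
lowDegreeShape (tensor {zero} {suc (suc _)} p q) = tt
lowDegreeShape (tensor {suc zero} {suc _} p q)   = tt
lowDegreeShape (tensor {suc (suc _)} p q)        = tt
lowDegreeShape (affine {zero} c D p _ (Ec , ec , Ec≤D)) with lowDegreeShape p
... | E , ev , E≤C = record
  { scalar = nothing ; slope = E ; offset = Ec
  ; leading-eq = sym ev
  ; offset-eq  = sym (trans (*-identityˡ (eval Ec)) ec)
  ; cost = +-mono-≤ E≤C Ec≤D
  }
lowDegreeShape (affine {suc _} c D p _ _) = tt

inP⇒affineShape : ∀ {f C} → InP f C → AffineShape f C
inP⇒affineShape (g , p , g≗f) = affineShape-resp g≗f (lowDegreeShape p)

inP-cost-lowerBound : ∀ {f : MPoly 1} {m C} → LowerBound (f (true ∷ [])) m → InP f C → m + 1 ≤ C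
inP-cost-lowerBound lb ip =
  ≤-trans (+-mono-≤ (lb (scalar ⊛? slope) (sym leading-eq)) (onesPos offset)) cost
  where open AffineShape (inP⇒affineShape ip)

ax+1-pair : ∀ {a m} → 1 ≤ a → HasCpxLE a m → LDPair 1 (linP (constP a) 1) (m + 1)
ax+1-pair {a} {m} a≥1 h = affine 1 1 (const a m a≥1 h) (s≤s z≤n) (one , refl , ≤-refl)

+-≤-componentwise : ∀ {x y u v} → x + y ≤ u + v → u ≤ x → v ≤ y → x ≤ u × y ≤ v
+-≤-componentwise {x} {y} {u} {v} le u≤x v≤y =
  +-cancelʳ-≤ y x u (≤-trans le (+-monoʳ-≤ u v≤y)) ,
  +-cancelˡ-≤ x y v (≤-trans le (+-monoˡ-≤ v u≤x))

substantial⇒stable-scaled-ax+1 : ∀ {f : MPoly 1} → Substantial f →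
  Σ (Maybe Expr) λ mb → Σ Expr λ e →
    Optimal (mb ⊛? e) × Stable (eval (mb ⊛? e)) × f ≗ₚ ax+c (eval (mb ⊛? e)) (evalM mb)
substantial⇒stable-scaled-ax+1 {f} (_ , s , (ip , _) , sc , refl) =
  scalar , slope , optimal , stable , f≗
  where
  open AffineShape (inP⇒affineShape ip)

  lb : LowerBound (eval (scalar ⊛? slope)) s
  lb = subst (λ n → LowerBound n s) leading-eq (stCpx-lowerBound sc)

  tight : ones (scalar ⊛? slope) ≤ s × ones offset ≤ 1
  tight = +-≤-componentwise cost (lb (scalar ⊛? slope) refl) (onesPos offset)

  optimal : Optimal (scalar ⊛? slope)
  optimal e ev = ≤-trans (proj₁ tight) (lb e ev)

  stable : Stable (eval (scalar ⊛? slope))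
  stable = stCpx-attained⇒stable (scalar ⊛? slope)
    (subst (λ n → StCpx n s) leading-eq sc) refl (proj₁ tight)

  f≗ : f ≗ₚ ax+c (eval (scalar ⊛? slope)) (evalM scalar)
  f≗ (true ∷ [])  = leading-eq
  f≗ (false ∷ []) = trans offset-eq
    (trans (cong (evalM scalar *_) (ones≤1⇒eval≡1 offset (proj₂ tight))) (*-identityʳ _))

stable⇒substantial : ∀ {f : MPoly 1} {L m} → f (true ∷ []) ≡ L → Stable L → Cpx L m →
                     InP f (m + 1) → Substantial f
stable⇒substantial {m = m} fL st cm ip =
  m + 1 , m ,
  (ip , λ _ → inP-cost-lowerBound (subst (λ n → LowerBound n m) (sym fL) (proj₂ cm))) ,
  subst (λ n → StCpx n m) (sym fL) (stable⇒stCpx st cm) , refl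

cpx⇒hasCpxLE : ∀ {n m} → Cpx n m → HasCpxLE n m
cpx⇒hasCpxLE ((E , ev , on) , _) = E , ev , ≤-reflexive on

ax+1-inP : ∀ {f a m} → f ≗ₚ ax+c a 1 → 1 ≤ a → Cpx a m → InP f (m + 1)
ax+1-inP f≗ a≥1 cm =
  _ , ax+1-pair a≥1 (cpx⇒hasCpxLE cm) ,
  λ { (true ∷ []) → sym (f≗ _) ; (false ∷ []) → sym (f≗ _) }

b[ax+1]-inP : ∀ {f a b ma mb} → f ≗ₚ ax+c (b * a) b → 1 ≤ a → 1 ≤ b →
              Cpx a ma → Cpx b mb → InP f (ma + mb + 1)
b[ax+1]-inP {b = b} {ma} {mb} f≗ a≥1 b≥1 ca cb =
  _ ,
  subst (LDPair 1 _) (trans (sym (+-assoc mb ma 1)) (cong (_+ 1) (+-comm mb ma)))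
    (tensor (const b mb b≥1 (cpx⇒hasCpxLE cb)) (ax+1-pair a≥1 (cpx⇒hasCpxLE ca))) ,
  λ { (true ∷ []) → sym (f≗ _) ; (false ∷ []) → trans (*-identityʳ b) (sym (f≗ _)) }

proposition3p9 : (f : MPoly 1) → LowDefect f →
    (Substantial f ⇔
    ((Σ ℕ λ a → 1 ≤ a × Stable a × f ≗ₚ ax+c a 1)
    ⊎ (Σ ℕ λ a → Σ ℕ λ b → 1 ≤ a × 1 ≤ b × Stable (a * b) × CpxAdditive a b
    × f ≗ₚ ax+c (b * a) b)))
proposition3p9 f _ = mk⇔ to from
  where
  to : Substantial f → _
  to sub with substantial⇒stable-scaled-ax+1 sub
  ... | nothing , a , _ , st , f≗ = inj₁ (eval a , evalPos a , st , f≗)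
  ... | just b , a , opt , st , f≗ =
    inj₂ (eval a , eval b , evalPos a , evalPos b , subst Stable (*-comm (eval b) (eval a)) st ,
          optimal-⊛⇒cpxAdditive b a opt , f≗)

  from : _ → Substantial f
  from (inj₁ (a , a≥1 , st@(m , cm , _) , f≗)) =
    stable⇒substantial (f≗ _) st cm (ax+1-inP f≗ a≥1 cm)
  from (inj₂ (a , b , a≥1 , b≥1 , st , (ma , mb , ca , cb , cab) , f≗)) =
    stable⇒substantial (trans (f≗ _) (*-comm b a)) st cab (b[ax+1]-inP f≗ a≥1 b≥1 ca cb)
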